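{- Let $\mathbf{L}\in\{\mathbf{K_n},\mathbf{KD_n}\}$ and let $\mathsf{G}(\mathbf{L})$ be the corresponding sequent calculus described in the context. All formulas below are formulas of $\mathcal{L}^1$. (Pre-interpolants.) For any formula $B(\overrightarrow{q},\overrightarrow{r})$, where the variables in $\overrightarrow{q}$ are all different from those in $\overrightarrow{r}$, there exists a formula $\mathcal{I}_{pre}(B,\overrightarrow{q})$ such that: (1) no variable of $\overrightarrow{r}$ occurs in $\mathcal{I}_{pre}(B,\overrightarrow{q})$; (2) $\mathcal{I}_{pre}(B,\overrightarrow{q})\Rightarrow B(\overrightarrow{q},\overrightarrow{r})$ is derivable in $\mathsf{G}(\mathbf{L})$; (3) for any formula $A(\overrightarrow{p},\overrightarrow{q})$, where the variables in $\overrightarrow{p}$ are all different from those in $\overrightarrow{q}$ and from those in $\overrightarrow{r}$, if $A(\overrightarrow{p},\overrightarrow{q})\Rightarrow B(\overrightarrow{q},\overrightarrow{r})$ is derivable in $\mathsf{G}(\mathbf{L})$, then $A(\overrightarrow{p},\overrightarrow{q})\Rightarrow \mathcal{I}_{pre}(B,\overrightarrow{q})$ is derivable in $\mathsf{G}(\mathbf{L})$. (Post-interpolants.) For any formula $A(\overrightarrow{p},\overrightarrow{q})$, where the variables in $\overrightarrow{q}$ are all different from those in $\overrightarrow{p}$, there exists a formula $\mathcal{I}_{post}(A,\overrightarrow{q})$ such that: (1) no variable of $\overrightarrow{p}$ occurs in $\mathcal{I}_{post}(A,\overrightarrow{q})$; (2) $A(\overrightarrow{p},\overrightarrow{q})\Rightarrow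 \mathcal{I}_{post}(A,\overrightarrow{q})$ is derivable in $\mathsf{G}(\mathbf{L})$; (3) for any formula $B(\overrightarrow{q},\overrightarrow{r})$, where the variables in $\overrightarrow{r}$ are all different from those in $\overrightarrow{q}$ and from those in $\overrightarrow{p}$, if $A(\overrightarrow{p},\overrightarrow{q})\Rightarrow B(\overrightarrow{q},\overrightarrow{r})$ is derivable in $\mathsf{G}(\mathbf{L})$, then $\mathcal{I}_{post}(A,\overrightarrow{q})\Rightarrow B(\overrightarrow{q},\overrightarrow{r})$ is derivable in $\mathsf{G}(\mathbf{L})$.
   Context: Fix a finite set $\mathsf{Agt}$ of agents and a countable set $\mathsf{Prop}$ of propositional variables. Formulas of $\mathcal{L}^1$: $A::=p\mid\bot\mid A\wedge A\mid A\vee A\mid A\rightarrow A\mid\neg A\mid\Box_i A$ ($p\in\mathsf{Prop}$, $i\in\mathsf{Agt}$). An outmost-boxed formula is one of the form $\Box_j B$. For a multiset $\Gamma$, $\Box_i\Gamma=\{\Box_iA: A\in\Gamma\}$. $\mathsf{V}(A)$ is the set of propositional variables in $A$; $A(\overrightarrow{q},\overrightarrow{r})$ means $\mathsf{V}(A)\subseteq\{\overrightarrow{q}\}\cup\{\overrightarrow{r}\}$, where $\overrightarrow{q}=q_1,\dots,q_m$ is a finite list of variables. A sequent $\Gamma\Rightarrow\Delta$ is a pair of finite multisets of formulas; commas denote multiset union. $\mathsf{G}(\mathbf{K_n})$: initial sequents $\Gamma,p\Rightarrow p,\Delta$ ($p\in\mathsf{Prop}$) and $\bot,\Gamma\Rightarrow\Delta$.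 Logical rules: $(R\wedge)$ from $\Gamma\Rightarrow\Delta,A_1$ and $\Gamma\Rightarrow\Delta,A_2$ infer $\Gamma\Rightarrow\Delta,A_1\wedge A_2$; $(L\wedge)$ from $A_1,A_2,\Gamma\Rightarrow\Delta$ infer $A_1\wedge A_2,\Gamma\Rightarrow\Delta$; $(R\vee)$ from $\Gamma\Rightarrow\Delta,A_1,A_2$ infer $\Gamma\Rightarrow\Delta,A_1\vee A_2$; $(L\vee)$ from $A_1,\Gamma\Rightarrow\Delta$ and $A_2,\Gamma\Rightarrow\Delta$ infer $A_1\vee A_2,\Gamma\Rightarrow\Delta$; $(R\rightarrow)$ from $A_1,\Gamma\Rightarrow\Delta,A_2$ infer $\Gamma\Rightarrow\Delta,A_1\rightarrow A_2$; $(L\rightarrow)$ from $\Gamma\Rightarrow\Delta,A_1$ and $A_2,\Gamma\Rightarrow\Delta$ infer $A_1\rightarrow A_2,\Gamma\Rightarrow\Delta$; $(R\neg)$ from $A,\Gamma\Rightarrow\Delta$ infer $\Gamma\Rightarrow\Delta,\neg A$; $(L\neg)$ from $\Gamma\Rightarrow\Delta,A$ infer $\neg A,\Gamma\Rightarrow\Delta$. Modal rule $(\Box_{Kn})$: from $\Gamma\Rightarrow A$ infer $\Sigma,\Box_i\Gamma\Rightarrow\Box_iA,\Omega$, where every member of $\Sigma$ is a propositional variable, $\bot$, or a formula $\Box_jB$ with $j\neq i$, and every member of $\Omega$ is a propositional variable, $\bot$, or an outmost-boxed formula. $\mathsf{G}(\mathbf{KD_n})$ adds $(\Box_{Dn})$: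 from $\Gamma\Rightarrow$ (empty succedent) with $\Gamma\neq\emptyset$ infer $\Sigma,\Box_i\Gamma\Rightarrow\Omega$, with $\Sigma,\Omega$ restricted as in $(\Box_{Kn})$. A sequent is derivable if it is the root of a finite tree built from initial sequents by these rules. -}

module Defs where

open import Data.Nat using (ℕ)
open import Data.Fin using (Fin)
open import Data.List using (List; []; _∷_; _++_; map)
open import Data.List.Relation.Binary.Permutation.Propositional using (_↭_)
open import Data.List.Membership.Propositional using (_∈_)
open import Data.List.Relation.Binary.Subset.Propositional using (_⊆_)
open import Data.List.Relation.Binary.Disjoint.Propositional using (Disjoint)
open import Relation.Binary.PropositionalEquality using (_≡_; _≢_)
open import Data.Product using (Σ; ∃; _×_)
open import Data.Sum using (_⊎_)

data Fm (n : ℕ) : Set where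
  var  : ℕ → Fm n
  ⊥'   : Fm n
  _∧'_ : Fm n → Fm n → Fm n
  _∨'_ : Fm n → Fm n → Fm n
  _⇒'_ : Fm n → Fm n → Fm n
  ¬'_  : Fm n → Fm n
  □    : Fin n → Fm n → Fm n

vars : ∀ {n} → Fm n → List ℕ
vars (var p)  = p ∷ []
vars ⊥'       = []
vars (A ∧' B) = vars A ++ vars B
vars (A ∨' B) = vars A ++ vars B
vars (A ⇒' B) = vars A ++ vars B
vars (¬' A)   = vars A
vars (□ i A)  = vars A

SideL : ∀ {n} → Fin n → Fm n → Set
SideL i A = (∃ λ p → A ≡ var p) ⊎ (A ≡ ⊥') ⊎ (Σ _ λ j → Σ _ λ B → A ≡ □ j B × j ≢ i)

SideR : ∀ {n} → Fm n → Set
SideR A = (∃ λ p → A ≡ var p) ⊎ (A ≡ ⊥') ⊎ (Σ _ λ j → Σ _ λ B → A ≡ □ j B)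

data AllF {n} (P : Fm n → Set) : List (Fm n) → Set where
  []  : AllF P []
  _∷_ : ∀ {A Γ} → P A → AllF P Γ → AllF P (A ∷ Γ)

data Logic : Set where
  Kn KDn : Logic

-- Sequents are pairs of finite multisets, represented as lists;
-- the multiset reading is captured by the rule `perm` (lists up to permutation).
infix 4 _∣_⊢_
data _∣_⊢_ {n : ℕ} (L : Logic) : List (Fm n) → List (Fm n) → Set where
  perm : ∀ {Γ Γ' Δ Δ'} → Γ ↭ Γ' → Δ ↭ Δ' → L ∣ Γ ⊢ Δ → L ∣ Γ' ⊢ Δ'
  ax   : ∀ {Γ Δ p} → L ∣ var p ∷ Γ ⊢ var p ∷ Δ
  ax⊥  : ∀ {Γ Δ} → L ∣ ⊥' ∷ Γ ⊢ Δ
  R∧ : ∀ {Γ Δ A₁ A₂} → L ∣ Γ ⊢ A₁ ∷ Δ → L ∣ Γ ⊢ A₂ ∷ Δ → L ∣ Γ ⊢ (A₁ ∧' A₂) ∷ Δ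
  L∧ : ∀ {Γ Δ A₁ A₂} → L ∣ A₁ ∷ A₂ ∷ Γ ⊢ Δ → L ∣ (A₁ ∧' A₂) ∷ Γ ⊢ Δ
  R∨ : ∀ {Γ Δ A₁ A₂} → L ∣ Γ ⊢ A₁ ∷ A₂ ∷ Δ → L ∣ Γ ⊢ (A₁ ∨' A₂) ∷ Δ
  L∨ : ∀ {Γ Δ A₁ A₂} → L ∣ A₁ ∷ Γ ⊢ Δ → L ∣ A₂ ∷ Γ ⊢ Δ → L ∣ (A₁ ∨' A₂) ∷ Γ ⊢ Δ
  R⇒ : ∀ {Γ Δ A₁ A₂} → L ∣ A₁ ∷ Γ ⊢ A₂ ∷ Δ → L ∣ Γ ⊢ (A₁ ⇒' A₂) ∷ Δ
  L⇒ : ∀ {Γ Δ A₁ A₂} → L ∣ Γ ⊢ A₁ ∷ Δ → L ∣ A₂ ∷ Γ ⊢ Δ → L ∣ (A₁ ⇒' A₂) ∷ Γ ⊢ Δ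
  R¬ : ∀ {Γ Δ A} → L ∣ A ∷ Γ ⊢ Δ → L ∣ Γ ⊢ (¬' A) ∷ Δ
  L¬ : ∀ {Γ Δ A} → L ∣ Γ ⊢ A ∷ Δ → L ∣ (¬' A) ∷ Γ ⊢ Δ
  □K : ∀ {Γ A Σs Ω} (i : Fin n) → AllF (SideL i) Σs → AllF SideR Ω →
       L ∣ Γ ⊢ A ∷ [] → L ∣ Σs ++ map (□ i) Γ ⊢ □ i A ∷ Ω
  □D : ∀ {Γ Σs Ω} (i : Fin n) → L ≡ KDn → Γ ≢ [] → AllF (SideL i) Σs → AllF SideR Ω →
       L ∣ Γ ⊢ [] → L ∣ Σs ++ map (□ i) Γ ⊢ Ω

-- A(xs): V(A) ⊆ xs
_over_ : ∀ {n} → Fm n → List ℕ → Set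
A over xs = vars A ⊆ xs

PreInterpolants : ℕ → Logic → Set
PreInterpolants n L =
  (B : Fm n) (qs rs : List ℕ) → Disjoint qs rs → B over (qs ++ rs) →
  Σ (Fm n) λ I →
    Disjoint (vars I) rs ×
    (L ∣ I ∷ [] ⊢ B ∷ []) ×
    ((A : Fm n) (ps : List ℕ) → Disjoint ps qs → Disjoint ps rs → A over (ps ++ qs) →
       L ∣ A ∷ [] ⊢ B ∷ [] → L ∣ A ∷ [] ⊢ I ∷ [])

PostInterpolants : ℕ → Logic → Set
PostInterpolants n L =
  (A : Fm n) (ps qs : List ℕ) → Disjoint qs ps → A over (ps ++ qs) →
  Σ (Fm n) λ I →
    Disjoint (vars I) ps ×
    (L ∣ A ∷ [] ⊢ I ∷ []) ×
    ((B : Fm n) (rs : List ℕ) → Disjoint rs qs → Disjoint rs ps → B over (qs ++ rs) →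
       L ∣ A ∷ [] ⊢ B ∷ [] → L ∣ I ∷ [] ⊢ B ∷ [])

{-# OPTIONS --safe #-}
-- Pitts-style uniform interpolation by backward proof search. For a sequent
-- Γ ⇒ Δ and a list rs of variables to forget, the formula 𝓘(Γ ⇒ Δ) is defined by
-- recursion on the size of Γ ⇒ Δ. If Γ ⇒ Δ contains a compound formula, it is
-- the conjunction of the interpolants of the premises of that formula's
-- (invertible) rule. Otherwise it is a disjunction with one member for each way
-- a derivation of Π, Γ ⇒ Δ, Λ, with Π ⇒ Λ free of rs, can end: an axiom
-- involving Γ ⇒ Δ, or a modal rule for agent i whose principal box □ᵢC is in Δ
-- (giving □ᵢ𝓘(Γᵢ ⇒ C)) or in Λ (giving ¬□ᵢ¬𝓘(Γᵢ ⇒ ∅)), where Γᵢ collects the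
-- formulas boxed by i in Γ. Induction on the size, using invertibility of the
-- propositional rules and admissibility of weakening, shows that
-- 𝓘(Γ ⇒ Δ), Γ ⇒ Δ is derivable, and that Π ⇒ 𝓘(Γ ⇒ Δ), Λ is derivable whenever
-- Π, Γ ⇒ Δ, Λ is. The pre-interpolant of B is 𝓘(∅ ⇒ B); the post-interpolant
-- of A is ¬𝓘(A ⇒ ∅).

module Submission where

open import Defs
open import Data.Empty using (⊥; ⊥-elim)
open import Data.Fin using (Fin; _≟_)
open import Data.List using (List; []; _∷_; _++_; map; concatMap; allFin)
open import Data.List.Properties using (map-++; ++-assoc; ++-identityʳ; ++-conicalˡ; ++-conicalʳ)
open import Data.List.Membership.Propositional using (_∈_; _∉_; lose; find)
open import Data.List.Membership.Propositional.Properties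
  using (∈-++⁺ˡ; ∈-++⁺ʳ; ∈-++⁻; ∈-map⁺; ∈-map⁻; ∈-∃++; ∈-concatMap⁺; ∈-concatMap⁻; ∈-allFin)
open import Data.List.Relation.Binary.Disjoint.Propositional using (Disjoint)
open import Data.List.Relation.Binary.Permutation.Propositional
open import Data.List.Relation.Binary.Permutation.Propositional.Properties
  using (∈-resp-↭; All-resp-↭; shift; shifts; drop-∷; ++⁺ˡ; ++⁺ʳ)
import Data.List.Relation.Binary.Permutation.Propositional.Properties as ↭
open import Data.List.Relation.Unary.All as All using (All; []; _∷_)
open import Data.List.Relation.Unary.All.Properties using (++⁺; ++⁻ˡ; ++⁻ʳ; concat⁺; map⁺)
open import Data.List.Relation.Unary.Any using (here; there; any?)
import Data.Nat as ℕ
open import Data.Nat using (ℕ; zero; suc; pred; _+_; _≤_; _<_; s≤s; s≤s⁻¹; z≤n)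
open import Data.Nat.ListAction using (sum)
open import Data.Nat.ListAction.Properties using (sum-++; sum-↭)
open import Data.Nat.Properties
  using ( ≤-refl; ≤-reflexive; ≤-trans; m≤m+n; m≤n+m; n≤1+n; +-identityʳ; +-monoʳ-≤; +-monoˡ-<
        ; +-mono-≤-<; pred-mono-≤; module ≤-Reasoning)
open import Data.List.Membership.DecPropositional ℕ._≟_ using (_∈?_)
open import Data.Product using (∃; Σ-syntax; _×_; _,_)
open import Data.Sum using (_⊎_; inj₁; inj₂; [_,_])
open import Function using (_∘_; id)
open import Relation.Binary.PropositionalEquality as ≡ using (_≡_; _≢_; refl; sym; cong; cong₂)
open import Relation.Nullary using (Dec; yes; no; ¬_)

module _ {A : Set} where

  ∷↭⇒∈ : ∀ {x : A} {xs ys} → x ∷ xs ↭ ys → x ∈ ys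
  ∷↭⇒∈ p = ∈-resp-↭ p (here refl)

  ∈⇒↭∷ : ∀ {x : A} {xs} → x ∈ xs → ∃ λ ys → xs ↭ x ∷ ys
  ∈⇒↭∷ x∈xs with ys , zs , refl ← ∈-∃++ x∈xs = ys ++ zs , shift _ ys zs

  data ∷↭∷-View (x : A) (xs : List A) (y : A) (ys : List A) : Set where
    same-head  : x ≡ y → xs ↭ ys → ∷↭∷-View x xs y ys
    other-head : ∀ zs → xs ↭ y ∷ zs → ys ↭ x ∷ zs → ∷↭∷-View x xs y ys

  ∷↭∷-view : ∀ {x xs y ys} → x ∷ xs ↭ y ∷ ys → ∷↭∷-View x xs y ys
  ∷↭∷-view {x} {y = y} p with ∷↭⇒∈ (↭-sym p)
  ... | here refl = same-head refl (drop-∷ p)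
  ... | there y∈xs with zs , xs↭ ← ∈⇒↭∷ y∈xs =
    other-head zs xs↭ (↭-sym (drop-∷ (trans (trans (swap y x refl) (prep x (↭-sym xs↭))) p)))

  ++⁺ˡ-assoc : ∀ as {Θ Π Γ : List A} → Θ ↭ Π ++ Γ → as ++ Θ ↭ (as ++ Π) ++ Γ
  ++⁺ˡ-assoc as {Π = Π} {Γ} h = trans (++⁺ˡ as h) (↭-reflexive (sym (++-assoc as Π Γ)))

  ++⁺ˡ-shifts : ∀ as {Ξ} (Δ : List A) {Λ} → Ξ ↭ Δ ++ Λ → as ++ Ξ ↭ Δ ++ (as ++ Λ)
  ++⁺ˡ-shifts as Δ h = trans (++⁺ˡ as h) (shifts as Δ)

-- Formulas and the propositional rules

module _ {n : ℕ} where

  AllF⇒All : ∀ {P : Fm n → Set} {Γ} → AllF P Γ → All P Γ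
  AllF⇒All []       = []
  AllF⇒All (p ∷ ps) = p ∷ AllF⇒All ps

  All⇒AllF : ∀ {P : Fm n → Set} {Γ} → All P Γ → AllF P Γ
  All⇒AllF []       = []
  All⇒AllF (p ∷ ps) = p ∷ All⇒AllF ps

  data Compound : Fm n → Set where
    ∧ᶜ : ∀ {A B} → Compound (A ∧' B)
    ∨ᶜ : ∀ {A B} → Compound (A ∨' B)
    ⇒ᶜ : ∀ {A B} → Compound (A ⇒' B)
    ¬ᶜ : ∀ {A} → Compound (¬' A)

  data Irreducible : Fm n → Set where
    varⁱ : ∀ {p} → Irreducible (var p)
    ⊥ⁱ   : Irreducible ⊥'
    □ⁱ   : ∀ {i A} → Irreducible (□ i A)

  compound⊎irreducible : (A : Fm n) → Compound A ⊎ Irreducible A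
  compound⊎irreducible (var _)  = inj₂ varⁱ
  compound⊎irreducible ⊥'       = inj₂ ⊥ⁱ
  compound⊎irreducible (_ ∧' _) = inj₁ ∧ᶜ
  compound⊎irreducible (_ ∨' _) = inj₁ ∨ᶜ
  compound⊎irreducible (_ ⇒' _) = inj₁ ⇒ᶜ
  compound⊎irreducible (¬' _)   = inj₁ ¬ᶜ
  compound⊎irreducible (□ _ _)  = inj₂ □ⁱ

  compound⇒¬irreducible : ∀ {A} → Compound A → ¬ Irreducible A
  compound⇒¬irreducible ∧ᶜ ()
  compound⇒¬irreducible ∨ᶜ ()
  compound⇒¬irreducible ⇒ᶜ ()
  compound⇒¬irreducible ¬ᶜ ()

  compound∉irreducible : ∀ {X Γ Γ'} → Compound X → All Irreducible Γ → Γ ↭ X ∷ Γ' → ⊥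
  compound∉irreducible c irrs Γ↭ = compound⇒¬irreducible c (All.lookup irrs (∷↭⇒∈ (↭-sym Γ↭)))

  irreducible⇒SideR : ∀ {A} → Irreducible A → SideR A
  irreducible⇒SideR (varⁱ {p}) = inj₁ (p , refl)
  irreducible⇒SideR ⊥ⁱ = inj₂ (inj₁ refl)
  irreducible⇒SideR (□ⁱ {i} {A}) = inj₂ (inj₂ (i , A , refl))

  SideR⇒irreducible : ∀ {A} → SideR A → Irreducible A
  SideR⇒irreducible (inj₁ (_ , refl)) = varⁱ
  SideR⇒irreducible (inj₂ (inj₁ refl)) = ⊥ⁱ
  SideR⇒irreducible (inj₂ (inj₂ (_ , _ , refl))) = □ⁱ

  All-SideR⇒irreducible : ∀ {Ω} → AllF SideR Ω → All Irreducible Ω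
  All-SideR⇒irreducible = All.map SideR⇒irreducible ∘ AllF⇒All

  All-irreducible⇒SideR : ∀ {Ω} → All Irreducible Ω → AllF SideR Ω
  All-irreducible⇒SideR = All⇒AllF ∘ All.map irreducible⇒SideR

  SideL⇒irreducible : ∀ {i} {A : Fm n} → SideL i A → Irreducible A
  SideL⇒irreducible (inj₁ (_ , refl)) = varⁱ
  SideL⇒irreducible (inj₂ (inj₁ refl)) = ⊥ⁱ
  SideL⇒irreducible (inj₂ (inj₂ (_ , _ , refl , _))) = □ⁱ

  infix 4 _⇒_
  record Sequent : Set where
    constructor _⇒_
    field
      ante succ : List (Fm n)

  open Sequent public

  -- A premise Π ⇒ Λ of the rule for X stands for Π, Γ ⇒ Λ, Δ over the rule's context Γ ⇒ Δ.
  premisesˡ premisesʳ : Fm n → List Sequent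
  premisesˡ (A ∧' B) = (A ∷ B ∷ [] ⇒ []) ∷ []
  premisesˡ (A ∨' B) = (A ∷ [] ⇒ []) ∷ (B ∷ [] ⇒ []) ∷ []
  premisesˡ (A ⇒' B) = ([] ⇒ A ∷ []) ∷ (B ∷ [] ⇒ []) ∷ []
  premisesˡ (¬' A)   = ([] ⇒ A ∷ []) ∷ []
  premisesˡ _        = []

  premisesʳ (A ∧' B) = ([] ⇒ A ∷ []) ∷ ([] ⇒ B ∷ []) ∷ []
  premisesʳ (A ∨' B) = ([] ⇒ A ∷ B ∷ []) ∷ []
  premisesʳ (A ⇒' B) = (A ∷ [] ⇒ B ∷ []) ∷ []
  premisesʳ (¬' A)   = (A ∷ [] ⇒ []) ∷ []
  premisesʳ _        = []

  data Shape (Γ Δ : List (Fm n)) : Set where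
    compoundˡ   : ∀ X Γ' → Compound X → Γ ↭ X ∷ Γ' → Shape Γ Δ
    compoundʳ   : ∀ X Δ' → Compound X → Δ ↭ X ∷ Δ' → Shape Γ Δ
    irreducible : All Irreducible Γ → All Irreducible Δ → Shape Γ Δ

  findCompound : ∀ Γ → (Σ[ X ∈ Fm n ] Σ[ Γ' ∈ List (Fm n) ] Compound X × Γ ↭ X ∷ Γ') ⊎ All Irreducible Γ
  findCompound [] = inj₂ []
  findCompound (A ∷ Γ) with compound⊎irreducible A | findCompound Γ
  ... | inj₁ c   | _                     = inj₁ (A , Γ , c , refl)
  ... | inj₂ _   | inj₁ (X , Γ' , c , p) = inj₁ (X , A ∷ Γ' , c , trans (prep A p) (swap A X refl))
  ... | inj₂ irr | inj₂ irrs             = inj₂ (irr ∷ irrs)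

  shape : ∀ Γ Δ → Shape Γ Δ
  shape Γ Δ with findCompound Γ | findCompound Δ
  ... | inj₁ (X , Γ' , c , p) | _                     = compoundˡ X Γ' c p
  ... | inj₂ _                | inj₁ (X , Δ' , c , p) = compoundʳ X Δ' c p
  ... | inj₂ irrΓ             | inj₂ irrΔ             = irreducible irrΓ irrΔ

  var-≟ : ∀ p (A : Fm n) → Dec (var p ≡ A)
  var-≟ p (var q) with p ℕ.≟ q
  ... | yes refl = yes refl
  ... | no p≢q   = no λ { refl → p≢q refl }
  var-≟ p ⊥'       = no λ ()
  var-≟ p (_ ∧' _) = no λ ()
  var-≟ p (_ ∨' _) = no λ ()
  var-≟ p (_ ⇒' _) = no λ ()
  var-≟ p (¬' _)   = no λ ()
  var-≟ p (□ _ _)  = no λ ()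

  ⊤' : Fm n
  ⊤' = ¬' ⊥'

  ⋀ ⋁ : List (Fm n) → Fm n
  ⋀ []       = ⊤'
  ⋀ (A ∷ As) = A ∧' ⋀ As
  ⋁ []       = ⊥'
  ⋁ (A ∷ As) = A ∨' ⋁ As

-- Size

module _ {n : ℕ} where

  size : Fm n → ℕ
  size (var _)  = 1
  size ⊥'       = 1
  size (A ∧' B) = suc (size A + size B)
  size (A ∨' B) = suc (size A + size B)
  size (A ⇒' B) = suc (size A + size B)
  size (¬' A)   = suc (size A)
  size (□ _ A)  = suc (size A)

  sizes : List (Fm n) → ℕ
  sizes Γ = sum (map size Γ)

  0<size : ∀ A → 0 < size A
  0<size (var _)  = s≤s z≤n
  0<size ⊥'       = s≤s z≤n
  0<size (_ ∧' _) = s≤s z≤n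
  0<size (_ ∨' _) = s≤s z≤n
  0<size (_ ⇒' _) = s≤s z≤n
  0<size (¬' _)   = s≤s z≤n
  0<size (□ _ _)  = s≤s z≤n

  sizes-++ : ∀ Γ Δ → sizes (Γ ++ Δ) ≡ sizes Γ + sizes Δ
  sizes-++ Γ Δ = ≡.trans (cong sum (map-++ size Γ Δ)) (sum-++ (map size Γ) (map size Δ))

  sizes-↭ : ∀ {Γ Δ} → Γ ↭ Δ → sizes Γ ≡ sizes Δ
  sizes-↭ p = sum-↭ (↭.map⁺ size p)

  size≤sizes : ∀ {A Γ} → A ∈ Γ → size A ≤ sizes Γ
  size≤sizes {Γ = B ∷ Γ} (here refl)  = m≤m+n (size B) (sizes Γ)
  size≤sizes {Γ = B ∷ Γ} (there A∈Γ) = ≤-trans (size≤sizes A∈Γ) (m≤n+m (sizes Γ) (size B))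

  sizes≤0 : ∀ Γ → sizes Γ ≤ 0 → Γ ≡ []
  sizes≤0 []      _ = refl
  sizes≤0 (A ∷ Γ) le with ≤-trans (0<size A) (≤-trans (m≤m+n (size A) (sizes Γ)) le)
  ... | ()

  premisesˡ-smaller : ∀ {X P} → P ∈ premisesˡ X → sizes (ante P ++ succ P) < size X
  premisesˡ-smaller {A ∧' B} (here refl) rewrite +-identityʳ (size B) = ≤-refl
  premisesˡ-smaller {A ∨' B} (here refl) rewrite +-identityʳ (size A) = s≤s (m≤m+n (size A) (size B))
  premisesˡ-smaller {A ∨' B} (there (here refl)) rewrite +-identityʳ (size B) = s≤s (m≤n+m (size B) (size A))
  premisesˡ-smaller {A ⇒' B} (here refl) rewrite +-identityʳ (size A) = s≤s (m≤m+n (size A) (size B))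
  premisesˡ-smaller {A ⇒' B} (there (here refl)) rewrite +-identityʳ (size B) = s≤s (m≤n+m (size B) (size A))
  premisesˡ-smaller {¬' A} (here refl) rewrite +-identityʳ (size A) = ≤-refl

  premisesʳ-smaller : ∀ {X P} → P ∈ premisesʳ X → sizes (ante P ++ succ P) < size X
  premisesʳ-smaller {A ∧' B} (here refl) rewrite +-identityʳ (size A) = s≤s (m≤m+n (size A) (size B))
  premisesʳ-smaller {A ∧' B} (there (here refl)) rewrite +-identityʳ (size B) = s≤s (m≤n+m (size B) (size A))
  premisesʳ-smaller {A ∨' B} (here refl) rewrite +-identityʳ (size B) = ≤-refl
  premisesʳ-smaller {A ⇒' B} (here refl) rewrite +-identityʳ (size B) = ≤-refl
  premisesʳ-smaller {¬' A} (here refl) rewrite +-identityʳ (size A) = ≤-refl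

  sizes-premise-context : ∀ a s g d {x} → sizes (a ++ s) < x →
                          sizes ((a ++ g) ++ (s ++ d)) < x + sizes (g ++ d)
  sizes-premise-context a s g d {x} lt = begin-strict
    sizes ((a ++ g) ++ (s ++ d))  ≡⟨ sizes-↭ regroup ⟩
    sizes ((a ++ s) ++ (g ++ d))  ≡⟨ sizes-++ (a ++ s) (g ++ d) ⟩
    sizes (a ++ s) + sizes (g ++ d) <⟨ +-monoˡ-< (sizes (g ++ d)) lt ⟩
    x + sizes (g ++ d)            ∎
    where
    open ≤-Reasoning
    regroup : (a ++ g) ++ (s ++ d) ↭ (a ++ s) ++ (g ++ d)
    regroup = trans (↭-reflexive (++-assoc a g (s ++ d)))
                (trans (++⁺ˡ a (shifts g s)) (↭-reflexive (sym (++-assoc a s (g ++ d)))))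

  premiseˡ-smaller : ∀ {X P Γ Γ'} Δ → P ∈ premisesˡ X → Γ ↭ X ∷ Γ' →
                     sizes ((ante P ++ Γ') ++ (succ P ++ Δ)) < sizes (Γ ++ Δ)
  premiseˡ-smaller {X} {P} {Γ' = Γ'} Δ P∈ Γ↭ =
    ≡.subst (_ <_) (sym (sizes-↭ (++⁺ʳ Δ Γ↭)))
      (sizes-premise-context (ante P) (succ P) Γ' Δ (premisesˡ-smaller P∈))

  premiseʳ-smaller : ∀ {X P Δ Δ'} Γ → P ∈ premisesʳ X → Δ ↭ X ∷ Δ' →
                     sizes ((ante P ++ Γ) ++ (succ P ++ Δ')) < sizes (Γ ++ Δ)
  premiseʳ-smaller {X} {P} {Δ' = Δ'} Γ P∈ Δ↭ =
    ≡.subst (_ <_) (sym (sizes-↭ (trans (++⁺ˡ Γ Δ↭) (shift X Γ Δ'))))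
      (sizes-premise-context (ante P) (succ P) Γ Δ' (premisesʳ-smaller P∈))

-- The boxes of one agent

module _ {n : ℕ} where

  data BoxView (i : Fin n) : Fm n → Set where
    boxed   : ∀ B → BoxView i (□ i B)
    unboxed : ∀ {A} → (∀ {B} → A ≢ □ i B) → BoxView i A

  boxView : ∀ i A → BoxView i A
  boxView i (□ j B) with j ≟ i
  ... | yes refl = boxed B
  ... | no j≢i   = unboxed λ { refl → j≢i refl }
  boxView i (var _)  = unboxed λ ()
  boxView i ⊥'       = unboxed λ ()
  boxView i (_ ∧' _) = unboxed λ ()
  boxView i (_ ∨' _) = unboxed λ ()
  boxView i (_ ⇒' _) = unboxed λ ()
  boxView i (¬' _)   = unboxed λ ()

  -- unbox i Γ is the Γᵢ above. Both go through unbox∷ and nonbox∷ rather than a with,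
  -- so that a proof can abstract boxView i A for several heads A at once.
  unbox∷ nonbox∷ : ∀ {i A} → BoxView i A → List (Fm n) → List (Fm n)
  unbox∷ (boxed B)   Γ = B ∷ Γ
  unbox∷ (unboxed _) Γ = Γ
  nonbox∷ (boxed _)       Γ = Γ
  nonbox∷ {A = A} (unboxed _) Γ = A ∷ Γ

  unbox nonbox : Fin n → List (Fm n) → List (Fm n)
  unbox i []       = []
  unbox i (A ∷ Γ)  = unbox∷ (boxView i A) (unbox i Γ)
  nonbox i []      = []
  nonbox i (A ∷ Γ) = nonbox∷ (boxView i A) (nonbox i Γ)

  ↭-nonbox-unbox : ∀ i Γ → Γ ↭ nonbox i Γ ++ map (□ i) (unbox i Γ)
  ↭-nonbox-unbox i [] = refl
  ↭-nonbox-unbox i (A ∷ Γ) with boxView i A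
  ... | boxed B   = trans (prep _ (↭-nonbox-unbox i Γ)) (↭-sym (shift (□ i B) (nonbox i Γ) _))
  ... | unboxed _ = prep A (↭-nonbox-unbox i Γ)

  unbox-++ : ∀ i Γ Δ → unbox i (Γ ++ Δ) ≡ unbox i Γ ++ unbox i Δ
  unbox-++ i [] Δ = refl
  unbox-++ i (A ∷ Γ) Δ with boxView i A
  ... | boxed B   = cong (B ∷_) (unbox-++ i Γ Δ)
  ... | unboxed _ = unbox-++ i Γ Δ

  nonbox-++ : ∀ i Γ Δ → nonbox i (Γ ++ Δ) ≡ nonbox i Γ ++ nonbox i Δ
  nonbox-++ i [] Δ = refl
  nonbox-++ i (A ∷ Γ) Δ with boxView i A
  ... | boxed _   = nonbox-++ i Γ Δ
  ... | unboxed _ = cong (A ∷_) (nonbox-++ i Γ Δ)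

  unbox-↭ : ∀ i {Γ Δ} → Γ ↭ Δ → unbox i Γ ↭ unbox i Δ
  unbox-↭ i refl = refl
  unbox-↭ i (prep A p) with boxView i A
  ... | boxed B   = prep B (unbox-↭ i p)
  ... | unboxed _ = unbox-↭ i p
  unbox-↭ i (swap A A' p) with boxView i A | boxView i A'
  ... | boxed B   | boxed B'  = swap B B' (unbox-↭ i p)
  ... | boxed B   | unboxed _ = prep B (unbox-↭ i p)
  ... | unboxed _ | boxed B'  = prep B' (unbox-↭ i p)
  ... | unboxed _ | unboxed _ = unbox-↭ i p
  unbox-↭ i (trans p q) = trans (unbox-↭ i p) (unbox-↭ i q)

  nonbox-↭ : ∀ i {Γ Δ} → Γ ↭ Δ → nonbox i Γ ↭ nonbox i Δ
  nonbox-↭ i refl = refl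
  nonbox-↭ i (prep A p) with boxView i A
  ... | boxed _   = nonbox-↭ i p
  ... | unboxed _ = prep A (nonbox-↭ i p)
  nonbox-↭ i (swap A A' p) with boxView i A | boxView i A'
  ... | boxed _   | boxed _   = nonbox-↭ i p
  ... | boxed _   | unboxed _ = prep A' (nonbox-↭ i p)
  ... | unboxed _ | boxed _   = prep A (nonbox-↭ i p)
  ... | unboxed _ | unboxed _ = swap A A' (nonbox-↭ i p)
  nonbox-↭ i (trans p q) = trans (nonbox-↭ i p) (nonbox-↭ i q)

  unbox-map□ : ∀ i Γ → unbox i (map (□ i) Γ) ≡ Γ
  unbox-map□ i [] = refl
  unbox-map□ i (A ∷ Γ) with boxView i (□ i A)
  ... | boxed _    = cong (A ∷_) (unbox-map□ i Γ)
  ... | unboxed ne = ⊥-elim (ne refl)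

  nonbox-map□ : ∀ i Γ → nonbox i (map (□ i) Γ) ≡ []
  nonbox-map□ i [] = refl
  nonbox-map□ i (A ∷ Γ) with boxView i (□ i A)
  ... | boxed _    = nonbox-map□ i Γ
  ... | unboxed ne = ⊥-elim (ne refl)

  SideL⇒unboxed : ∀ {i} {A : Fm n} → SideL i A → ∀ {B} → A ≢ □ i B
  SideL⇒unboxed (inj₁ (_ , refl)) ()
  SideL⇒unboxed (inj₂ (inj₁ refl)) ()
  SideL⇒unboxed (inj₂ (inj₂ (_ , _ , refl , j≢i))) refl = j≢i refl

  irreducible⇒SideL : ∀ {i} {A : Fm n} → Irreducible A → (∀ {B} → A ≢ □ i B) → SideL i A
  irreducible⇒SideL (varⁱ {p})   _  = inj₁ (p , refl)
  irreducible⇒SideL ⊥ⁱ           _  = inj₂ (inj₁ refl)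
  irreducible⇒SideL (□ⁱ {j} {B}) ne = inj₂ (inj₂ (j , B , refl , λ { refl → ne refl }))

  unbox-SideL : ∀ i {Σs} → AllF (SideL i) Σs → unbox i Σs ≡ []
  unbox-SideL i [] = refl
  unbox-SideL i {A ∷ _} (s ∷ ss) with boxView i A
  ... | boxed _   = ⊥-elim (SideL⇒unboxed s refl)
  ... | unboxed _ = unbox-SideL i ss

  nonbox-SideL : ∀ i {Σs} → AllF (SideL i) Σs → nonbox i Σs ≡ Σs
  nonbox-SideL i [] = refl
  nonbox-SideL i {A ∷ _} (s ∷ ss) with boxView i A
  ... | boxed _   = ⊥-elim (SideL⇒unboxed s refl)
  ... | unboxed _ = cong (A ∷_) (nonbox-SideL i ss)

  nonbox-SideL⁺ : ∀ i {Γ} → All Irreducible Γ → AllF (SideL i) (nonbox i Γ)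
  nonbox-SideL⁺ i [] = []
  nonbox-SideL⁺ i {A ∷ _} (irr ∷ irrs) with boxView i A
  ... | boxed _    = nonbox-SideL⁺ i irrs
  ... | unboxed ne = irreducible⇒SideL irr ne ∷ nonbox-SideL⁺ i irrs

  All-unbox : ∀ {P : Fm n → Set} i → (∀ {B} → P (□ i B) → P B) → ∀ {Γ} → All P Γ → All P (unbox i Γ)
  All-unbox i P□⇒P [] = []
  All-unbox i P□⇒P {A ∷ _} (pA ∷ ps) with boxView i A
  ... | boxed _   = P□⇒P pA ∷ All-unbox i P□⇒P ps
  ... | unboxed _ = All-unbox i P□⇒P ps

  unbox-modal : ∀ i {Σs} Γ → AllF (SideL i) Σs → unbox i (Σs ++ map (□ i) Γ) ≡ Γ
  unbox-modal i {Σs} Γ ss =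
    ≡.trans (unbox-++ i Σs (map (□ i) Γ)) (cong₂ _++_ (unbox-SideL i ss) (unbox-map□ i Γ))

  nonbox-modal : ∀ i {Σs} Γ → AllF (SideL i) Σs → nonbox i (Σs ++ map (□ i) Γ) ≡ Σs
  nonbox-modal i {Σs} Γ ss =
    ≡.trans (nonbox-++ i Σs (map (□ i) Γ))
      (≡.trans (cong₂ _++_ (nonbox-SideL i ss) (nonbox-map□ i Γ)) (++-identityʳ Σs))

  modal-split : ∀ i {Σs Γ} Π {Π'} → AllF (SideL i) Σs → Σs ++ map (□ i) Γ ↭ Π ++ Π' →
                Γ ↭ unbox i Π ++ unbox i Π' × AllF (SideL i) (nonbox i Π)
  modal-split i {Σs} {Γ} Π {Π'} ss h =
    unbox↭ , All⇒AllF (++⁻ˡ (nonbox i Π) (All-resp-↭ nonbox↭ (AllF⇒All ss)))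
    where
    unbox↭ : Γ ↭ unbox i Π ++ unbox i Π'
    unbox↭ = ≡.subst₂ _↭_ (unbox-modal i Γ ss) (unbox-++ i Π Π') (unbox-↭ i h)
    nonbox↭ : Σs ↭ nonbox i Π ++ nonbox i Π'
    nonbox↭ = ≡.subst₂ _↭_ (nonbox-modal i Γ ss) (nonbox-++ i Π Π') (nonbox-↭ i h)

  ↭-boxed-context : ∀ i Γ Π → nonbox i Π ++ map (□ i) (Γ ++ unbox i Π) ↭ map (□ i) Γ ++ Π
  ↭-boxed-context i Γ Π =
    trans (↭-reflexive (cong (nonbox i Π ++_) (map-++ (□ i) Γ (unbox i Π))))
      (trans (shifts (nonbox i Π) (map (□ i) Γ)) (++⁺ˡ (map (□ i) Γ) (↭-sym (↭-nonbox-unbox i Π))))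

  irreducible-modal-antecedent : ∀ (i : Fin n) {Σs} Γ → AllF (SideL i) Σs →
                                 All Irreducible (Σs ++ map (□ i) Γ)
  irreducible-modal-antecedent i Γ ss =
    ++⁺ (All.map SideL⇒irreducible (AllF⇒All ss)) (map⁺ (All.universal (λ _ → □ⁱ) Γ))

  sizes-unbox : ∀ i Γ → sizes (unbox i Γ) ≤ sizes Γ
  sizes-unbox i [] = ≤-refl
  sizes-unbox i (A ∷ Γ) with boxView i A
  ... | boxed B   = ≤-trans (+-monoʳ-≤ (size B) (sizes-unbox i Γ)) (n≤1+n _)
  ... | unboxed _ = ≤-trans (sizes-unbox i Γ) (m≤n+m (sizes Γ) (size A))

  sizes-unbox-pred : ∀ i Γ → sizes (unbox i Γ) ≤ pred (sizes Γ)
  sizes-unbox-pred i [] = ≤-refl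
  sizes-unbox-pred i (A ∷ Γ) with boxView i A
  ... | boxed B   = +-monoʳ-≤ (size B) (sizes-unbox i Γ)
  ... | unboxed _ with size A | 0<size A
  ...   | suc m | _ = ≤-trans (sizes-unbox i Γ) (m≤n+m (sizes Γ) m)

  box-premise-smaller : ∀ {i C} Γ {Δ} → □ i C ∈ Δ → sizes (unbox i Γ ++ C ∷ []) < sizes (Γ ++ Δ)
  box-premise-smaller {i} {C} Γ {Δ} □C∈Δ = begin-strict
    sizes (unbox i Γ ++ C ∷ [])       ≡⟨ sizes-++ (unbox i Γ) (C ∷ []) ⟩
    sizes (unbox i Γ) + (size C + 0)  <⟨ +-mono-≤-< (sizes-unbox i Γ) C<Δ ⟩
    sizes Γ + sizes Δ                 ≡⟨ sym (sizes-++ Γ Δ) ⟩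
    sizes (Γ ++ Δ)                    ∎
    where
    open ≤-Reasoning
    C<Δ : size C + 0 < sizes Δ
    C<Δ = ≤-trans (s≤s (≤-reflexive (+-identityʳ (size C)))) (size≤sizes □C∈Δ)

  diamond-premise-smaller : ∀ i Γ Δ → sizes (unbox i Γ ++ []) ≤ pred (sizes (Γ ++ Δ))
  diamond-premise-smaller i Γ Δ = begin
    sizes (unbox i Γ ++ [])  ≡⟨ cong sizes (++-identityʳ (unbox i Γ)) ⟩
    sizes (unbox i Γ)        ≤⟨ sizes-unbox-pred i Γ ⟩
    pred (sizes Γ)           ≤⟨ pred-mono-≤ (m≤m+n (sizes Γ) (sizes Δ)) ⟩
    pred (sizes Γ + sizes Δ) ≡⟨ cong pred (sym (sizes-++ Γ Δ)) ⟩
    pred (sizes (Γ ++ Δ))    ∎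
    where open ≤-Reasoning

module Interpolant {n : ℕ} (rs : List ℕ) where

  Free : Fm n → Set
  Free A = All (_∉ rs) (vars A)

  -- An atom of Γ closes Γ ⇒ Δ by itself (⊤) or meets p in Λ (¬ p); an atom of Δ meets p in Π (p).
  axiomˡ : List (Fm n) → Fm n → List (Fm n)
  axiomˡ Δ ⊥' = ⊤' ∷ []
  axiomˡ Δ (var p) with any? (var-≟ p) Δ | p ∈? rs
  ... | yes _ | _     = ⊤' ∷ []
  ... | no _  | yes _ = []
  ... | no _  | no _  = ¬' var p ∷ []
  axiomˡ Δ _ = []

  axiomʳ : Fm n → List (Fm n)
  axiomʳ (var p) with p ∈? rs
  ... | yes _ = []
  ... | no _  = var p ∷ []
  axiomʳ _ = []

  Interpolator : Set
  Interpolator = List (Fm n) → List (Fm n) → Fm n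

  boxʳ : Interpolator → List (Fm n) → Fm n → List (Fm n)
  boxʳ rec Γ (□ i C) = □ i (rec (unbox i Γ) (C ∷ [])) ∷ []
  boxʳ rec Γ _       = []

  diamond : Interpolator → List (Fm n) → Fin n → Fm n
  diamond rec Γ i = ¬' □ i (¬' rec (unbox i Γ) [])

  disjuncts : Interpolator → List (Fm n) → List (Fm n) → List (Fm n)
  disjuncts rec Γ Δ = concatMap (axiomˡ Δ) Γ ++ concatMap axiomʳ Δ
                   ++ concatMap (boxʳ rec Γ) Δ ++ map (diamond rec Γ) (allFin n)

  𝓘-step : Interpolator → ∀ Γ Δ → Shape Γ Δ → Fm n
  𝓘-step rec Γ Δ (compoundˡ X Γ' _ _) = ⋀ (map (λ P → rec (ante P ++ Γ') (succ P ++ Δ)) (premisesˡ X))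
  𝓘-step rec Γ Δ (compoundʳ X Δ' _ _) = ⋀ (map (λ P → rec (ante P ++ Γ) (succ P ++ Δ')) (premisesʳ X))
  𝓘-step rec Γ Δ (irreducible _ _)    = ⋁ (disjuncts rec Γ Δ)

  -- 𝓘 k Γ Δ is the interpolant only when sizes (Γ ++ Δ) ≤ k; below that the fuel runs out at ⊥'.
  𝓘 : ℕ → Interpolator
  𝓘 zero    _ _ = ⊥'
  𝓘 (suc k) Γ Δ = 𝓘-step (𝓘 k) Γ Δ (shape Γ Δ)

  interpolant : Interpolator
  interpolant Γ Δ = 𝓘 (sizes (Γ ++ Δ)) Γ Δ

  data Disjunct (rec : Interpolator) (Γ Δ : List (Fm n)) : Fm n → Set where
    axiomˡ-disjunct  : ∀ {A J} → A ∈ Γ → J ∈ axiomˡ Δ A → Disjunct rec Γ Δ J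
    axiomʳ-disjunct  : ∀ {A J} → A ∈ Δ → J ∈ axiomʳ A → Disjunct rec Γ Δ J
    boxʳ-disjunct    : ∀ {A J} → A ∈ Δ → J ∈ boxʳ rec Γ A → Disjunct rec Γ Δ J
    diamond-disjunct : ∀ i → Disjunct rec Γ Δ (diamond rec Γ i)

  ∈-disjuncts⁺ : ∀ {rec Γ Δ J} → Disjunct rec Γ Δ J → J ∈ disjuncts rec Γ Δ
  ∈-disjuncts⁺ {Δ = Δ} (axiomˡ-disjunct A∈ J∈) = ∈-++⁺ˡ (∈-concatMap⁺ (axiomˡ Δ) (lose A∈ J∈))
  ∈-disjuncts⁺ {Γ = Γ} {Δ} (axiomʳ-disjunct A∈ J∈) =
    ∈-++⁺ʳ (concatMap (axiomˡ Δ) Γ) (∈-++⁺ˡ (∈-concatMap⁺ axiomʳ (lose A∈ J∈)))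
  ∈-disjuncts⁺ {rec} {Γ} {Δ} (boxʳ-disjunct A∈ J∈) =
    ∈-++⁺ʳ (concatMap (axiomˡ Δ) Γ) (∈-++⁺ʳ (concatMap axiomʳ Δ)
      (∈-++⁺ˡ (∈-concatMap⁺ (boxʳ rec Γ) (lose A∈ J∈))))
  ∈-disjuncts⁺ {rec} {Γ} {Δ} (diamond-disjunct i) =
    ∈-++⁺ʳ (concatMap (axiomˡ Δ) Γ) (∈-++⁺ʳ (concatMap axiomʳ Δ)
      (∈-++⁺ʳ (concatMap (boxʳ rec Γ) Δ) (∈-map⁺ (diamond rec Γ) (∈-allFin i))))

  ∈-disjuncts⁻ : ∀ {rec Γ Δ J} → J ∈ disjuncts rec Γ Δ → Disjunct rec Γ Δ J
  ∈-disjuncts⁻ {rec} {Γ} {Δ} J∈ with ∈-++⁻ (concatMap (axiomˡ Δ) Γ) J∈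
  ... | inj₁ J∈ˡ = let _ , A∈ , J∈A = find (∈-concatMap⁻ (axiomˡ Δ) J∈ˡ) in axiomˡ-disjunct A∈ J∈A
  ... | inj₂ J∈₁ with ∈-++⁻ (concatMap axiomʳ Δ) J∈₁
  ... | inj₁ J∈ʳ = let _ , A∈ , J∈A = find (∈-concatMap⁻ axiomʳ J∈ʳ) in axiomʳ-disjunct A∈ J∈A
  ... | inj₂ J∈₂ with ∈-++⁻ (concatMap (boxʳ rec Γ) Δ) J∈₂
  ... | inj₁ J∈□ = let _ , A∈ , J∈A = find (∈-concatMap⁻ (boxʳ rec Γ) J∈□) in boxʳ-disjunct A∈ J∈A
  ... | inj₂ J∈◇ with ∈-map⁻ (diamond rec Γ) J∈◇
  ... | i , _ , refl = diamond-disjunct i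

  ⊤∈axiomˡ : ∀ {p Δ} → var p ∈ Δ → ⊤' ∈ axiomˡ Δ (var p)
  ⊤∈axiomˡ {p} {Δ} p∈Δ with any? (var-≟ p) Δ | p ∈? rs
  ... | yes _  | _ = here refl
  ... | no p∉Δ | _ = ⊥-elim (p∉Δ p∈Δ)

  axiomˡ-free : ∀ {p Δ} → p ∉ rs → ⊤' ∈ axiomˡ Δ (var p) ⊎ ¬' var p ∈ axiomˡ Δ (var p)
  axiomˡ-free {p} {Δ} p∉ with any? (var-≟ p) Δ | p ∈? rs
  ... | yes _ | _      = inj₁ (here refl)
  ... | no _  | yes p∈ = ⊥-elim (p∉ p∈)
  ... | no _  | no _   = inj₂ (here refl)

  var∈axiomʳ : ∀ {p} → p ∉ rs → var p ∈ axiomʳ (var p)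
  var∈axiomʳ {p} p∉ with p ∈? rs
  ... | yes p∈ = ⊥-elim (p∉ p∈)
  ... | no _   = here refl

  Free-var : ∀ {p} → Free (var p) → p ∉ rs
  Free-var (p∉ ∷ []) = p∉

  premisesˡ-Free : ∀ {X P} → Free X → P ∈ premisesˡ X → All Free (ante P) × All Free (succ P)
  premisesˡ-Free {A ∧' B} f (here refl)         = (++⁻ˡ (vars A) f ∷ ++⁻ʳ (vars A) f ∷ []) , []
  premisesˡ-Free {A ∨' B} f (here refl)         = (++⁻ˡ (vars A) f ∷ []) , []
  premisesˡ-Free {A ∨' B} f (there (here refl)) = (++⁻ʳ (vars A) f ∷ []) , []
  premisesˡ-Free {A ⇒' B} f (here refl)         = [] , (++⁻ˡ (vars A) f ∷ [])
  premisesˡ-Free {A ⇒' B} f (there (here refl)) = (++⁻ʳ (vars A) f ∷ []) , []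
  premisesˡ-Free {¬' A}   f (here refl)         = [] , (f ∷ [])

  premisesʳ-Free : ∀ {X P} → Free X → P ∈ premisesʳ X → All Free (ante P) × All Free (succ P)
  premisesʳ-Free {A ∧' B} f (here refl)         = [] , (++⁻ˡ (vars A) f ∷ [])
  premisesʳ-Free {A ∧' B} f (there (here refl)) = [] , (++⁻ʳ (vars A) f ∷ [])
  premisesʳ-Free {A ∨' B} f (here refl)         = [] , (++⁻ˡ (vars A) f ∷ ++⁻ʳ (vars A) f ∷ [])
  premisesʳ-Free {A ⇒' B} f (here refl)         = (++⁻ˡ (vars A) f ∷ []) , (++⁻ʳ (vars A) f ∷ [])
  premisesʳ-Free {¬' A}   f (here refl)         = (f ∷ []) , []

  over⇒Free : ∀ A xs {ys} → Disjoint xs rs → Disjoint ys rs → A over (xs ++ ys) → Free A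
  over⇒Free A xs xs#rs ys#rs A⊆ = All.tabulate λ x∈A x∈rs →
    [ (λ x∈xs → xs#rs (x∈xs , x∈rs)) , (λ x∈ys → ys#rs (x∈ys , x∈rs)) ] (∈-++⁻ xs (A⊆ x∈A))

  Free⇒Disjoint : ∀ A → Free A → Disjoint (vars A) rs
  Free⇒Disjoint A fA (x∈A , x∈rs) = All.lookup fA x∈A x∈rs

  Free-⋀ : ∀ {As} → All Free As → Free (⋀ As)
  Free-⋀ []       = []
  Free-⋀ (f ∷ fs) = ++⁺ f (Free-⋀ fs)

  Free-⋁ : ∀ {As} → All Free As → Free (⋁ As)
  Free-⋁ []       = []
  Free-⋁ (f ∷ fs) = ++⁺ f (Free-⋁ fs)

  Free-concatMap : ∀ {f : Fm n → List (Fm n)} → (∀ A → All Free (f A)) → ∀ Γ → All Free (concatMap f Γ)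
  Free-concatMap Free-f Γ = concat⁺ (map⁺ (All.universal Free-f Γ))

  Free-axiomˡ : ∀ Δ A → All Free (axiomˡ Δ A)
  Free-axiomˡ Δ ⊥' = [] ∷ []
  Free-axiomˡ Δ (var p) with any? (var-≟ p) Δ | p ∈? rs
  ... | yes _ | _     = [] ∷ []
  ... | no _  | yes _ = []
  ... | no _  | no p∉ = (p∉ ∷ []) ∷ []
  Free-axiomˡ Δ (_ ∧' _) = []
  Free-axiomˡ Δ (_ ∨' _) = []
  Free-axiomˡ Δ (_ ⇒' _) = []
  Free-axiomˡ Δ (¬' _)   = []
  Free-axiomˡ Δ (□ _ _)  = []

  Free-axiomʳ : ∀ A → All Free (axiomʳ A)
  Free-axiomʳ (var p) with p ∈? rs
  ... | yes _ = []
  ... | no p∉ = (p∉ ∷ []) ∷ []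
  Free-axiomʳ ⊥'       = []
  Free-axiomʳ (_ ∧' _) = []
  Free-axiomʳ (_ ∨' _) = []
  Free-axiomʳ (_ ⇒' _) = []
  Free-axiomʳ (¬' _)   = []
  Free-axiomʳ (□ _ _)  = []

  module _ {rec : Interpolator} (Free-rec : ∀ Γ Δ → Free (rec Γ Δ)) where

    Free-boxʳ : ∀ Γ A → All Free (boxʳ rec Γ A)
    Free-boxʳ Γ (□ i C)  = Free-rec (unbox i Γ) (C ∷ []) ∷ []
    Free-boxʳ Γ (var _)  = []
    Free-boxʳ Γ ⊥'       = []
    Free-boxʳ Γ (_ ∧' _) = []
    Free-boxʳ Γ (_ ∨' _) = []
    Free-boxʳ Γ (_ ⇒' _) = []
    Free-boxʳ Γ (¬' _)   = []

    Free-disjuncts : ∀ Γ Δ → All Free (disjuncts rec Γ Δ)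
    Free-disjuncts Γ Δ =
      ++⁺ (Free-concatMap (Free-axiomˡ Δ) Γ) (++⁺ (Free-concatMap Free-axiomʳ Δ)
        (++⁺ (Free-concatMap (Free-boxʳ Γ) Δ)
          (map⁺ (All.universal (λ i → Free-rec (unbox i Γ) []) (allFin n)))))

    Free-𝓘-step : ∀ Γ Δ s → Free (𝓘-step rec Γ Δ s)
    Free-𝓘-step Γ Δ (compoundˡ X Γ' _ _) =
      Free-⋀ (map⁺ (All.universal (λ P → Free-rec (ante P ++ Γ') (succ P ++ Δ)) (premisesˡ X)))
    Free-𝓘-step Γ Δ (compoundʳ X Δ' _ _) =
      Free-⋀ (map⁺ (All.universal (λ P → Free-rec (ante P ++ Γ) (succ P ++ Δ')) (premisesʳ X)))
    Free-𝓘-step Γ Δ (irreducible _ _) = Free-⋁ (Free-disjuncts Γ Δ)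

  Free-𝓘 : ∀ k Γ Δ → Free (𝓘 k Γ Δ)
  Free-𝓘 zero    Γ Δ = []
  Free-𝓘 (suc k) Γ Δ = Free-𝓘-step (Free-𝓘 k) Γ Δ (shape Γ Δ)

  Free-interpolant : ∀ Γ Δ → Free (interpolant Γ Δ)
  Free-interpolant Γ Δ = Free-𝓘 (sizes (Γ ++ Δ)) Γ Δ

module Derivations {n : ℕ} (L : Logic) where

  private variable
    A B X : Fm n
    Γ Δ Γ' Δ' Π Ω Θ Ξ Θ' Ξ' : List (Fm n)
    i : Fin n
    p : ℕ

  -- L ∣_⊢_ with its eight propositional rules folded into ruleˡ and ruleʳ.
  infix 4 _⊢_
  data _⊢_ : List (Fm n) → List (Fm n) → Set where
    perm  : Γ ↭ Γ' → Δ ↭ Δ' → Γ ⊢ Δ → Γ' ⊢ Δ'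
    ax    : var p ∷ Γ ⊢ var p ∷ Δ
    ax⊥   : ⊥' ∷ Γ ⊢ Δ
    ruleˡ : ∀ X → Compound X → (∀ {P} → P ∈ premisesˡ X → ante P ++ Γ ⊢ succ P ++ Δ) → X ∷ Γ ⊢ Δ
    ruleʳ : ∀ X → Compound X → (∀ {P} → P ∈ premisesʳ X → ante P ++ Γ ⊢ succ P ++ Δ) → Γ ⊢ X ∷ Δ
    □K    : ∀ {Σs} (i : Fin n) → AllF (SideL i) Σs → AllF SideR Ω →
            Γ ⊢ A ∷ [] → Σs ++ map (□ i) Γ ⊢ □ i A ∷ Ω
    □D    : ∀ {Σs} (i : Fin n) → L ≡ KDn → Γ ≢ [] → AllF (SideL i) Σs → AllF SideR Ω →
            Γ ⊢ [] → Σs ++ map (□ i) Γ ⊢ Ω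

  ∧ˡ : A ∷ B ∷ Γ ⊢ Δ → A ∧' B ∷ Γ ⊢ Δ
  ∧ˡ d = ruleˡ _ ∧ᶜ λ { (here refl) → d ; (there ()) }

  ∧ʳ : Γ ⊢ A ∷ Δ → Γ ⊢ B ∷ Δ → Γ ⊢ A ∧' B ∷ Δ
  ∧ʳ d e = ruleʳ _ ∧ᶜ λ { (here refl) → d ; (there (here refl)) → e ; (there (there ())) }

  ∨ˡ : A ∷ Γ ⊢ Δ → B ∷ Γ ⊢ Δ → A ∨' B ∷ Γ ⊢ Δ
  ∨ˡ d e = ruleˡ _ ∨ᶜ λ { (here refl) → d ; (there (here refl)) → e ; (there (there ())) }

  ∨ʳ : Γ ⊢ A ∷ B ∷ Δ → Γ ⊢ A ∨' B ∷ Δ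
  ∨ʳ d = ruleʳ _ ∨ᶜ λ { (here refl) → d ; (there ()) }

  ⇒ˡ : Γ ⊢ A ∷ Δ → B ∷ Γ ⊢ Δ → A ⇒' B ∷ Γ ⊢ Δ
  ⇒ˡ d e = ruleˡ _ ⇒ᶜ λ { (here refl) → d ; (there (here refl)) → e ; (there (there ())) }

  ⇒ʳ : A ∷ Γ ⊢ B ∷ Δ → Γ ⊢ A ⇒' B ∷ Δ
  ⇒ʳ d = ruleʳ _ ⇒ᶜ λ { (here refl) → d ; (there ()) }

  ¬ˡ : Γ ⊢ A ∷ Δ → ¬' A ∷ Γ ⊢ Δ
  ¬ˡ d = ruleˡ _ ¬ᶜ λ { (here refl) → d ; (there ()) }

  ¬ʳ : A ∷ Γ ⊢ Δ → Γ ⊢ ¬' A ∷ Δ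
  ¬ʳ d = ruleʳ _ ¬ᶜ λ { (here refl) → d ; (there ()) }

  from∣⊢ : L ∣ Γ ⊢ Δ → Γ ⊢ Δ
  from∣⊢ (perm p q d)      = perm p q (from∣⊢ d)
  from∣⊢ ax                = ax
  from∣⊢ ax⊥               = ax⊥
  from∣⊢ (R∧ d e)          = ∧ʳ (from∣⊢ d) (from∣⊢ e)
  from∣⊢ (L∧ d)            = ∧ˡ (from∣⊢ d)
  from∣⊢ (R∨ d)            = ∨ʳ (from∣⊢ d)
  from∣⊢ (L∨ d e)          = ∨ˡ (from∣⊢ d) (from∣⊢ e)
  from∣⊢ (R⇒ d)            = ⇒ʳ (from∣⊢ d)
  from∣⊢ (L⇒ d e)          = ⇒ˡ (from∣⊢ d) (from∣⊢ e)
  from∣⊢ (R¬ d)            = ¬ʳ (from∣⊢ d)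
  from∣⊢ (L¬ d)            = ¬ˡ (from∣⊢ d)
  from∣⊢ (□K i s o d)      = □K i s o (from∣⊢ d)
  from∣⊢ (□D i e ne s o d) = □D i e ne s o (from∣⊢ d)

  to∣⊢ : Γ ⊢ Δ → L ∣ Γ ⊢ Δ
  to∣⊢ (perm p q d)      = perm p q (to∣⊢ d)
  to∣⊢ ax                = ax
  to∣⊢ ax⊥               = ax⊥
  to∣⊢ (ruleˡ _ ∧ᶜ d)    = L∧ (to∣⊢ (d (here refl)))
  to∣⊢ (ruleˡ _ ∨ᶜ d)    = L∨ (to∣⊢ (d (here refl))) (to∣⊢ (d (there (here refl))))
  to∣⊢ (ruleˡ _ ⇒ᶜ d)    = L⇒ (to∣⊢ (d (here refl))) (to∣⊢ (d (there (here refl))))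
  to∣⊢ (ruleˡ _ ¬ᶜ d)    = L¬ (to∣⊢ (d (here refl)))
  to∣⊢ (ruleʳ _ ∧ᶜ d)    = R∧ (to∣⊢ (d (here refl))) (to∣⊢ (d (there (here refl))))
  to∣⊢ (ruleʳ _ ∨ᶜ d)    = R∨ (to∣⊢ (d (here refl)))
  to∣⊢ (ruleʳ _ ⇒ᶜ d)    = R⇒ (to∣⊢ (d (here refl)))
  to∣⊢ (ruleʳ _ ¬ᶜ d)    = R¬ (to∣⊢ (d (here refl)))
  to∣⊢ (□K i s o d)      = □K i s o (to∣⊢ d)
  to∣⊢ (□D i e ne s o d) = □D i e ne s o (to∣⊢ d)

  -- An irreducible formula becomes a side formula of a modal rule, except □ i B
  -- below the rule for i, which weakens the premise by B instead.
  mutual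
    weakenˡ : ∀ A → Γ ⊢ Δ → A ∷ Γ ⊢ Δ
    weakenˡ (var _)  = weakenˡ-irreducible varⁱ
    weakenˡ ⊥'       = weakenˡ-irreducible ⊥ⁱ
    weakenˡ (□ _ _)  = weakenˡ-irreducible □ⁱ
    weakenˡ (A ∧' B) d = ∧ˡ (weakenˡ A (weakenˡ B d))
    weakenˡ (A ∨' B) d = ∨ˡ (weakenˡ A d) (weakenˡ B d)
    weakenˡ (A ⇒' B) d = ⇒ˡ (weakenʳ A d) (weakenˡ B d)
    weakenˡ (¬' A)   d = ¬ˡ (weakenʳ A d)

    weakenʳ : ∀ A → Γ ⊢ Δ → Γ ⊢ A ∷ Δ
    weakenʳ (var _)  = weakenʳ-irreducible varⁱ
    weakenʳ ⊥'       = weakenʳ-irreducible ⊥ⁱ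
    weakenʳ (□ _ _)  = weakenʳ-irreducible □ⁱ
    weakenʳ (A ∧' B) d = ∧ʳ (weakenʳ A d) (weakenʳ B d)
    weakenʳ (A ∨' B) d = ∨ʳ (weakenʳ A (weakenʳ B d))
    weakenʳ (A ⇒' B) d = ⇒ʳ (weakenˡ A (weakenʳ B d))
    weakenʳ (¬' A)   d = ¬ʳ (weakenˡ A d)

    weakenˡ-irreducible : Irreducible A → Γ ⊢ Δ → A ∷ Γ ⊢ Δ
    weakenˡ-irreducible irr (perm p q d) = perm (prep _ p) q (weakenˡ-irreducible irr d)
    weakenˡ-irreducible irr ax  = perm (swap _ _ refl) refl ax
    weakenˡ-irreducible irr ax⊥ = perm (swap _ _ refl) refl ax⊥
    weakenˡ-irreducible {A = A} irr (ruleˡ X c d) =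
      perm (swap X A refl) refl (ruleˡ X c λ {P} P∈ →
        perm (↭-sym (shift A (ante P) _)) refl (weakenˡ-irreducible irr (d P∈)))
    weakenˡ-irreducible {A = A} irr (ruleʳ X c d) =
      ruleʳ X c λ {P} P∈ → perm (↭-sym (shift A (ante P) _)) refl (weakenˡ-irreducible irr (d P∈))
    weakenˡ-irreducible {A = A} irr (□K {Σs = Σs} i s o d) with boxView i A
    ... | boxed B    = perm (shift (□ i B) Σs _) refl (□K i s o (weakenˡ B d))
    ... | unboxed ne = □K i (irreducible⇒SideL irr ne ∷ s) o d
    weakenˡ-irreducible {A = A} irr (□D {Σs = Σs} i e ne s o d) with boxView i A
    ... | boxed B     = perm (shift (□ i B) Σs _) refl (□D i e (λ ()) s o (weakenˡ B d))
    ... | unboxed ne′ = □D i e ne (irreducible⇒SideL irr ne′ ∷ s) o d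

    weakenʳ-irreducible : Irreducible A → Γ ⊢ Δ → Γ ⊢ A ∷ Δ
    weakenʳ-irreducible irr (perm p q d) = perm p (prep _ q) (weakenʳ-irreducible irr d)
    weakenʳ-irreducible irr ax  = perm refl (swap _ _ refl) ax
    weakenʳ-irreducible irr ax⊥ = ax⊥
    weakenʳ-irreducible {A = A} irr (ruleˡ X c d) =
      ruleˡ X c λ {P} P∈ → perm refl (↭-sym (shift A (succ P) _)) (weakenʳ-irreducible irr (d P∈))
    weakenʳ-irreducible {A = A} irr (ruleʳ X c d) =
      perm refl (swap X A refl) (ruleʳ X c λ {P} P∈ →
        perm refl (↭-sym (shift A (succ P) _)) (weakenʳ-irreducible irr (d P∈)))
    weakenʳ-irreducible irr (□K i s o d) =
      perm refl (swap _ _ refl) (□K i s (irreducible⇒SideR irr ∷ o) d)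
    weakenʳ-irreducible irr (□D i e ne s o d) = □D i e ne s (irreducible⇒SideR irr ∷ o) d

  invertˡ : Θ ⊢ Ξ → Θ ↭ X ∷ Θ' → Compound X → ∀ {P} → P ∈ premisesˡ X → ante P ++ Θ' ⊢ succ P ++ Ξ
  invertˡ (perm p q d) h c {P} P∈ = perm refl (++⁺ˡ (succ P) q) (invertˡ d (trans p h) c P∈)
  invertˡ ax h c {P} P∈ with ∷↭∷-view h
  ... | same-head refl _    = ⊥-elim (compound⇒¬irreducible c varⁱ)
  ... | other-head zs _ Θ'↭ =
    perm (trans (↭-sym (shift _ (ante P) zs)) (++⁺ˡ (ante P) (↭-sym Θ'↭))) (↭-sym (shift _ (succ P) _)) ax
  invertˡ ax⊥ h c {P} P∈ with ∷↭∷-view h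
  ... | same-head refl _    = ⊥-elim (compound⇒¬irreducible c ⊥ⁱ)
  ... | other-head zs _ Θ'↭ = perm (trans (↭-sym (shift _ (ante P) zs)) (++⁺ˡ (ante P) (↭-sym Θ'↭))) refl ax⊥
  invertˡ {X = X} (ruleˡ Y c′ d) h c {P} P∈ with ∷↭∷-view h
  ... | same-head refl Γ↭Θ' = perm (++⁺ˡ (ante P) Γ↭Θ') refl (d P∈)
  ... | other-head zs Γ↭ Θ'↭ =
    perm (trans (↭-sym (shift Y (ante P) zs)) (++⁺ˡ (ante P) (↭-sym Θ'↭))) refl
      (ruleˡ Y c′ λ {Q} Q∈ → perm (shifts (ante P) (ante Q)) (shifts (succ P) (succ Q))
        (invertˡ (d Q∈) (trans (++⁺ˡ (ante Q) Γ↭) (shift X (ante Q) zs)) c P∈))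
  invertˡ {X = X} (ruleʳ {Γ = Γ} {Δ = Δ} Y c′ d) h c {P} P∈ =
    perm refl (↭-sym (shift Y (succ P) Δ))
      (ruleʳ Y c′ λ {Q} Q∈ → perm (shifts (ante P) (ante Q)) (shifts (succ P) (succ Q))
        (invertˡ (d Q∈) (trans (++⁺ˡ (ante Q) h) (shift X (ante Q) _)) c P∈))
  invertˡ (□K i s o d) h c P∈      = ⊥-elim (compound∉irreducible c (irreducible-modal-antecedent i _ s) h)
  invertˡ (□D i e ne s o d) h c P∈ = ⊥-elim (compound∉irreducible c (irreducible-modal-antecedent i _ s) h)

  invertʳ : Θ ⊢ Ξ → Ξ ↭ X ∷ Ξ' → Compound X → ∀ {P} → P ∈ premisesʳ X → ante P ++ Θ ⊢ succ P ++ Ξ'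
  invertʳ (perm p q d) h c {P} P∈ = perm (++⁺ˡ (ante P) p) refl (invertʳ d (trans q h) c P∈)
  invertʳ (ax {Γ = Γ}) h c {P} P∈ with ∷↭∷-view h
  ... | same-head refl _    = ⊥-elim (compound⇒¬irreducible c varⁱ)
  ... | other-head zs _ Ξ'↭ =
    perm (↭-sym (shift _ (ante P) Γ)) (trans (↭-sym (shift _ (succ P) zs)) (++⁺ˡ (succ P) (↭-sym Ξ'↭))) ax
  invertʳ (ax⊥ {Γ = Γ}) h c {P} P∈ = perm (↭-sym (shift ⊥' (ante P) Γ)) refl ax⊥
  invertʳ {X = X} (ruleˡ {Γ = Γ} Y c′ d) h c {P} P∈ =
    perm (↭-sym (shift Y (ante P) Γ)) refl
      (ruleˡ Y c′ λ {Q} Q∈ → perm (shifts (ante P) (ante Q)) (shifts (succ P) (succ Q))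
        (invertʳ (d Q∈) (trans (++⁺ˡ (succ Q) h) (shift X (succ Q) _)) c P∈))
  invertʳ {X = X} (ruleʳ Y c′ d) h c {P} P∈ with ∷↭∷-view h
  ... | same-head refl Δ↭Ξ' = perm refl (++⁺ˡ (succ P) Δ↭Ξ') (d P∈)
  ... | other-head zs Δ↭ Ξ'↭ =
    perm refl (trans (↭-sym (shift Y (succ P) zs)) (++⁺ˡ (succ P) (↭-sym Ξ'↭)))
      (ruleʳ Y c′ λ {Q} Q∈ → perm (shifts (ante P) (ante Q)) (shifts (succ P) (succ Q))
        (invertʳ (d Q∈) (trans (++⁺ˡ (succ Q) Δ↭) (shift X (succ Q) zs)) c P∈))
  invertʳ (□K i s o d) h c P∈      = ⊥-elim (compound∉irreducible c (□ⁱ ∷ All-SideR⇒irreducible o) h)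
  invertʳ (□D i e ne s o d) h c P∈ = ⊥-elim (compound∉irreducible c (All-SideR⇒irreducible o) h)

  ax∈ : var p ∈ Γ → var p ∈ Δ → Γ ⊢ Δ
  ax∈ p∈Γ p∈Δ with _ , Γ↭ ← ∈⇒↭∷ p∈Γ | _ , Δ↭ ← ∈⇒↭∷ p∈Δ = perm (↭-sym Γ↭) (↭-sym Δ↭) ax

  ⊥∈ : ⊥' ∈ Γ → Γ ⊢ Δ
  ⊥∈ ⊥∈Γ with _ , Γ↭ ← ∈⇒↭∷ ⊥∈Γ = perm (↭-sym Γ↭) refl ax⊥

  ⊤ʳ : Γ ⊢ ⊤' ∷ Δ
  ⊤ʳ = ¬ʳ ax⊥

  ⋀-left : ∀ {As} → A ∈ As → A ∷ Γ ⊢ Δ → ⋀ As ∷ Γ ⊢ Δ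
  ⋀-left {As = _ ∷ As} (here refl) d = ∧ˡ (perm (swap _ _ refl) refl (weakenˡ (⋀ As) d))
  ⋀-left {As = B ∷ _}  (there A∈) d = ∧ˡ (weakenˡ B (⋀-left A∈ d))

  ⋀-map-right : ∀ {S : Set} {f : S → Fm n} {xs} → (∀ {x} → x ∈ xs → Γ ⊢ f x ∷ Δ) → Γ ⊢ ⋀ (map f xs) ∷ Δ
  ⋀-map-right {xs = []}    h = ⊤ʳ
  ⋀-map-right {xs = _ ∷ _} h = ∧ʳ (h (here refl)) (⋀-map-right (h ∘ there))

  ⋁-left : ∀ {As} → (∀ {A} → A ∈ As → A ∷ Γ ⊢ Δ) → ⋁ As ∷ Γ ⊢ Δ
  ⋁-left {As = []}    h = ax⊥
  ⋁-left {As = _ ∷ _} h = ∨ˡ (h (here refl)) (⋁-left (h ∘ there))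

  ⋁-right : ∀ {As} → A ∈ As → Γ ⊢ A ∷ Δ → Γ ⊢ ⋁ As ∷ Δ
  ⋁-right {As = _ ∷ As} (here refl) d = ∨ʳ (perm refl (swap _ _ refl) (weakenʳ (⋁ As) d))
  ⋁-right {As = B ∷ _}  (there A∈) d = ∨ʳ (weakenʳ B (⋁-right A∈ d))

  □K′ : ∀ Γ {Π} → AllF (SideL i) (nonbox i Π) → AllF SideR Ω →
        Γ ++ unbox i Π ⊢ A ∷ [] → map (□ i) Γ ++ Π ⊢ □ i A ∷ Ω
  □K′ {i = i} Γ {Π} s o d = perm (↭-boxed-context i Γ Π) refl (□K i s o d)

  □D′ : L ≡ KDn → ∀ Γ {Π} → Γ ≢ [] → AllF (SideL i) (nonbox i Π) → AllF SideR Ω →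
        Γ ++ unbox i Π ⊢ [] → map (□ i) Γ ++ Π ⊢ Ω
  □D′ {i = i} KD Γ {Π} Γ≢[] s o d =
    perm (↭-boxed-context i Γ Π) refl (□D i KD (Γ≢[] ∘ ++-conicalˡ Γ (unbox i Π)) s o d)

module Correctness {n : ℕ} (L : Logic) (rs : List ℕ) where

  open Derivations {n} L
  open Interpolant {n} rs

  Sound : Interpolator → Set
  Sound rec = ∀ Γ Δ → rec Γ Δ ∷ Γ ⊢ Δ

  axiomˡ-sound : ∀ {Γ J} Δ A → A ∈ Γ → J ∈ axiomˡ Δ A → J ∷ Γ ⊢ Δ
  axiomˡ-sound Δ ⊥' ⊥∈Γ (here refl) = weakenˡ ⊤' (⊥∈ ⊥∈Γ)
  axiomˡ-sound Δ (var p) p∈Γ J∈ with any? (var-≟ p) Δ | p ∈? rs | J∈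
  ... | yes p∈Δ | _     | here refl = weakenˡ ⊤' (ax∈ p∈Γ p∈Δ)
  ... | no _    | no _  | here refl = ¬ˡ (ax∈ p∈Γ (here refl))

  axiomʳ-sound : ∀ {Γ Δ J} A → A ∈ Δ → J ∈ axiomʳ A → J ∷ Γ ⊢ Δ
  axiomʳ-sound (var p) p∈Δ J∈ with p ∈? rs | J∈
  ... | no _ | here refl = ax∈ (here refl) p∈Δ

  module _ {rec : Interpolator} (rec-sound : Sound rec)
           {Γ Δ : List (Fm n)} (irrΓ : All Irreducible Γ) (irrΔ : All Irreducible Δ) where

    boxʳ-sound : ∀ {A J} → A ∈ Δ → J ∈ boxʳ rec Γ A → J ∷ Γ ⊢ Δ
    boxʳ-sound {□ i C} □C∈Δ (here refl) with Δ' , Δ↭ ← ∈⇒↭∷ □C∈Δ =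
      perm refl (↭-sym Δ↭)
        (□K′ (_ ∷ []) (nonbox-SideL⁺ i irrΓ) (All-irreducible⇒SideR (All.tail (All-resp-↭ Δ↭ irrΔ)))
          (rec-sound (unbox i Γ) (C ∷ [])))

    diamond-sound : ∀ i → diamond rec Γ i ∷ Γ ⊢ Δ
    diamond-sound i =
      ¬ˡ (□K′ [] (nonbox-SideL⁺ i irrΓ) (All-irreducible⇒SideR irrΔ) (¬ʳ (rec-sound (unbox i Γ) [])))

    disjunct-sound : ∀ {J} → Disjunct rec Γ Δ J → J ∷ Γ ⊢ Δ
    disjunct-sound (axiomˡ-disjunct A∈ J∈) = axiomˡ-sound Δ _ A∈ J∈
    disjunct-sound (axiomʳ-disjunct A∈ J∈) = axiomʳ-sound _ A∈ J∈
    disjunct-sound (boxʳ-disjunct A∈ J∈)   = boxʳ-sound A∈ J∈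
    disjunct-sound (diamond-disjunct i)    = diamond-sound i

  𝓘-step-sound : ∀ {rec} → Sound rec → ∀ Γ Δ s → 𝓘-step rec Γ Δ s ∷ Γ ⊢ Δ
  𝓘-step-sound rec-sound Γ Δ (compoundˡ X Γ' c Γ↭) =
    perm (trans (swap X _ refl) (prep _ (↭-sym Γ↭))) refl
      (ruleˡ X c λ {P} P∈ → perm (↭-sym (shift _ (ante P) Γ')) refl
        (⋀-left (∈-map⁺ _ P∈) (rec-sound (ante P ++ Γ') (succ P ++ Δ))))
  𝓘-step-sound rec-sound Γ Δ (compoundʳ X Δ' c Δ↭) =
    perm refl (↭-sym Δ↭)
      (ruleʳ X c λ {P} P∈ → perm (↭-sym (shift _ (ante P) Γ)) refl
        (⋀-left (∈-map⁺ _ P∈) (rec-sound (ante P ++ Γ) (succ P ++ Δ'))))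
  𝓘-step-sound rec-sound Γ Δ (irreducible irrΓ irrΔ) =
    ⋁-left λ J∈ → disjunct-sound rec-sound irrΓ irrΔ (∈-disjuncts⁻ J∈)

  𝓘-sound : ∀ k → Sound (𝓘 k)
  𝓘-sound zero    Γ Δ = ax⊥
  𝓘-sound (suc k) Γ Δ = 𝓘-step-sound (𝓘-sound k) Γ Δ (shape Γ Δ)

  -- Property (3) for an arbitrary rs-free context Π ⇒ Λ (A ⇒ ∅ for pre-, ∅ ⇒ B for
  -- post-interpolants); this generality is what lets the induction go through.
  Uniform : Fm n → List (Fm n) → List (Fm n) → Set
  Uniform I Γ Δ = ∀ {Π Λ} → All Free Π → All Free Λ → Π ++ Γ ⊢ Δ ++ Λ → Π ⊢ I ∷ Λ

  UniformUpTo : ℕ → Interpolator → Set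
  UniformUpTo k rec = ∀ Γ Δ → sizes (Γ ++ Δ) ≤ k → Uniform (rec Γ Δ) Γ Δ

  module IrreducibleCase {k} {rec : Interpolator} (IH : UniformUpTo k rec)
                         {Γ Δ : List (Fm n)} (irrΓ : All Irreducible Γ) (irrΔ : All Irreducible Δ)
                         (bound : sizes (Γ ++ Δ) ≤ suc k) where

    ⋁Γ⇒Δ : Fm n
    ⋁Γ⇒Δ = ⋁ (disjuncts rec Γ Δ)

    disjunct-right : ∀ {Π Λ J} → Disjunct rec Γ Δ J → Π ⊢ J ∷ Λ → Π ⊢ ⋁Γ⇒Δ ∷ Λ
    disjunct-right J∈ = ⋁-right (∈-disjuncts⁺ J∈)

    axiom-uniform : ∀ {p Π Λ} → All Free Π → All Free Λ → var p ∈ Π ++ Γ → var p ∈ Δ ++ Λ → Π ⊢ ⋁Γ⇒Δ ∷ Λ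
    axiom-uniform {Π = Π} fΠ fΛ p∈ˡ p∈ʳ with ∈-++⁻ Π p∈ˡ | ∈-++⁻ Δ p∈ʳ
    ... | inj₁ p∈Π | inj₂ p∈Λ = weakenʳ _ (ax∈ p∈Π p∈Λ)
    ... | inj₁ p∈Π | inj₁ p∈Δ =
      disjunct-right (axiomʳ-disjunct p∈Δ (var∈axiomʳ (Free-var (All.lookup fΠ p∈Π)))) (ax∈ p∈Π (here refl))
    ... | inj₂ p∈Γ | inj₁ p∈Δ = disjunct-right (axiomˡ-disjunct p∈Γ (⊤∈axiomˡ p∈Δ)) ⊤ʳ
    ... | inj₂ p∈Γ | inj₂ p∈Λ with axiomˡ-free {Δ = Δ} (Free-var (All.lookup fΛ p∈Λ))
    ...   | inj₁ ⊤∈  = disjunct-right (axiomˡ-disjunct p∈Γ ⊤∈) ⊤ʳ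
    ...   | inj₂ ¬p∈ = disjunct-right (axiomˡ-disjunct p∈Γ ¬p∈) (¬ʳ (ax∈ (here refl) p∈Λ))

    ⊥-uniform : ∀ {Π Λ} → ⊥' ∈ Π ++ Γ → Π ⊢ ⋁Γ⇒Δ ∷ Λ
    ⊥-uniform {Π} ⊥∈ˡ with ∈-++⁻ Π ⊥∈ˡ
    ... | inj₁ ⊥∈Π = weakenʳ _ (⊥∈ ⊥∈Π)
    ... | inj₂ ⊥∈Γ = disjunct-right (axiomˡ-disjunct ⊥∈Γ (here refl)) ⊤ʳ

    irreducible-suffix : ∀ {Ξ Λ} → All Irreducible Ξ → Ξ ↭ Δ ++ Λ → All Irreducible Λ
    irreducible-suffix irrΞ Ξ↭ = ++⁻ʳ Δ (All-resp-↭ Ξ↭ irrΞ)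

    box-bound : ∀ {i C} → □ i C ∈ Δ → sizes (unbox i Γ ++ C ∷ []) ≤ k
    box-bound □C∈Δ = s≤s⁻¹ (≤-trans (box-premise-smaller Γ □C∈Δ) bound)

    diamond-bound : ∀ i → sizes (unbox i Γ ++ []) ≤ k
    diamond-bound i = ≤-trans (diamond-premise-smaller i Γ Δ) (pred-mono-≤ bound)

    □K-uniform : ∀ {i Σs Γm C Ω Π Λ} → All Free Π → All Free Λ → AllF (SideL i) Σs → AllF SideR Ω →
                 Γm ⊢ C ∷ [] → Σs ++ map (□ i) Γm ↭ Π ++ Γ → □ i C ∷ Ω ↭ Δ ++ Λ → Π ⊢ ⋁Γ⇒Δ ∷ Λ
    □K-uniform {i} {C = C} {Π = Π} fΠ fΛ s o d hΘ hΞ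
      with modal-split i Π s hΘ | ∈-++⁻ Δ (∷↭⇒∈ hΞ)
         | irreducible-suffix (□ⁱ ∷ All-SideR⇒irreducible o) hΞ
    ... | Γm↭ , sΠ | inj₁ □C∈Δ | irrΛ =
      disjunct-right (boxʳ-disjunct □C∈Δ (here refl))
        (□K′ [] sΠ (All-irreducible⇒SideR irrΛ)
          (IH (unbox i Γ) (C ∷ []) (box-bound □C∈Δ) (All-unbox i id fΠ) [] (perm Γm↭ refl d)))
    ... | Γm↭ , sΠ | inj₂ □C∈Λ | irrΛ with Λ' , Λ↭ ← ∈⇒↭∷ □C∈Λ =
      disjunct-right (diamond-disjunct i)
        (¬ʳ (perm refl (↭-sym Λ↭)
          (□K′ (_ ∷ []) sΠ (All-irreducible⇒SideR (All.tail (All-resp-↭ Λ↭ irrΛ)))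
            (¬ˡ (IH (unbox i Γ) [] (diamond-bound i) (All-unbox i id fΠ) (All.lookup fΛ □C∈Λ ∷ [])
                   (perm Γm↭ refl d))))))

    □D-uniform : ∀ {i Σs Γm Ω Π Λ} → L ≡ KDn → All Free Π → AllF (SideL i) Σs → AllF SideR Ω →
                 Γm ⊢ [] → Σs ++ map (□ i) Γm ↭ Π ++ Γ → Ω ↭ Δ ++ Λ → Π ⊢ ⋁Γ⇒Δ ∷ Λ
    □D-uniform {i} {Π = Π} KD fΠ s o d hΘ hΞ with Γm↭ , sΠ ← modal-split i Π s hΘ =
      disjunct-right (diamond-disjunct i)
        (¬ʳ (□D′ KD (_ ∷ []) (λ ()) sΠ
          (All-irreducible⇒SideR (irreducible-suffix (All-SideR⇒irreducible o) hΞ))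
          (¬ˡ (IH (unbox i Γ) [] (diamond-bound i) (All-unbox i id fΠ) [] (perm Γm↭ refl d)))))

    irreducible-uniform : ∀ {Θ Ξ Π Λ} → All Free Π → All Free Λ → Θ ⊢ Ξ → Θ ↭ Π ++ Γ → Ξ ↭ Δ ++ Λ →
                          Π ⊢ ⋁Γ⇒Δ ∷ Λ
    irreducible-uniform fΠ fΛ (perm p q d) hΘ hΞ = irreducible-uniform fΠ fΛ d (trans p hΘ) (trans q hΞ)
    irreducible-uniform fΠ fΛ ax hΘ hΞ = axiom-uniform fΠ fΛ (∷↭⇒∈ hΘ) (∷↭⇒∈ hΞ)
    irreducible-uniform fΠ fΛ ax⊥ hΘ hΞ = ⊥-uniform (∷↭⇒∈ hΘ)
    irreducible-uniform {Π = Π} {Λ} fΠ fΛ (ruleˡ X c d) hΘ hΞ with ∈-++⁻ Π (∷↭⇒∈ hΘ)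
    ... | inj₂ X∈Γ = ⊥-elim (compound⇒¬irreducible c (All.lookup irrΓ X∈Γ))
    ... | inj₁ X∈Π with Π' , Π↭ ← ∈⇒↭∷ X∈Π =
      perm (↭-sym Π↭) refl (ruleˡ X c λ {P} P∈ →
        let fa , fs = premisesˡ-Free (All.lookup fΠ X∈Π) P∈ in
        perm refl (↭-sym (shift _ (succ P) Λ))
          (irreducible-uniform (++⁺ fa (All.tail (All-resp-↭ Π↭ fΠ))) (++⁺ fs fΛ) (d P∈)
            (++⁺ˡ-assoc (ante P) (drop-∷ (trans hΘ (++⁺ʳ Γ Π↭)))) (++⁺ˡ-shifts (succ P) Δ hΞ)))
    irreducible-uniform {Π = Π} {Λ} fΠ fΛ (ruleʳ X c d) hΘ hΞ with ∈-++⁻ Δ (∷↭⇒∈ hΞ)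
    ... | inj₁ X∈Δ = ⊥-elim (compound⇒¬irreducible c (All.lookup irrΔ X∈Δ))
    ... | inj₂ X∈Λ with Λ' , Λ↭ ← ∈⇒↭∷ X∈Λ =
      perm refl (trans (swap X _ refl) (prep _ (↭-sym Λ↭))) (ruleʳ X c λ {P} P∈ →
        let fa , fs = premisesʳ-Free (All.lookup fΛ X∈Λ) P∈ in
        perm refl (↭-sym (shift _ (succ P) Λ'))
          (irreducible-uniform (++⁺ fa fΠ) (++⁺ fs (All.tail (All-resp-↭ Λ↭ fΛ))) (d P∈)
            (++⁺ˡ-assoc (ante P) hΘ)
            (++⁺ˡ-shifts (succ P) Δ (drop-∷ (trans hΞ (trans (++⁺ˡ Δ Λ↭) (shift X Δ Λ')))))))
    irreducible-uniform fΠ fΛ (□K i s o d) hΘ hΞ      = □K-uniform fΠ fΛ s o d hΘ hΞ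
    irreducible-uniform fΠ fΛ (□D i KD _ s o d) hΘ hΞ = □D-uniform KD fΠ s o d hΘ hΞ

  𝓘-step-uniform : ∀ {k rec} → UniformUpTo k rec → ∀ Γ Δ s → sizes (Γ ++ Δ) ≤ suc k →
                   Uniform (𝓘-step rec Γ Δ s) Γ Δ
  𝓘-step-uniform IH Γ Δ (compoundˡ X Γ' c Γ↭) bound {Π} {Λ} fΠ fΛ d =
    ⋀-map-right λ {P} P∈ →
      IH (ante P ++ Γ') (succ P ++ Δ) (s≤s⁻¹ (≤-trans (premiseˡ-smaller Δ P∈ Γ↭) bound)) fΠ fΛ
        (perm (shifts (ante P) Π) (↭-reflexive (sym (++-assoc (succ P) Δ Λ)))
          (invertˡ d (trans (++⁺ˡ Π Γ↭) (shift X Π Γ')) c P∈))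
  𝓘-step-uniform IH Γ Δ (compoundʳ X Δ' c Δ↭) bound {Π} {Λ} fΠ fΛ d =
    ⋀-map-right λ {P} P∈ →
      IH (ante P ++ Γ) (succ P ++ Δ') (s≤s⁻¹ (≤-trans (premiseʳ-smaller Γ P∈ Δ↭) bound)) fΠ fΛ
        (perm (shifts (ante P) Π) (↭-reflexive (sym (++-assoc (succ P) Δ' Λ)))
          (invertʳ d (++⁺ʳ Λ Δ↭) c P∈))
  𝓘-step-uniform IH Γ Δ (irreducible irrΓ irrΔ) bound fΠ fΛ d =
    IrreducibleCase.irreducible-uniform IH irrΓ irrΔ bound fΠ fΛ d refl refl

  𝓘-uniform : ∀ k → UniformUpTo k (𝓘 k)
  𝓘-uniform zero Γ Δ bound fΠ fΛ d
    with refl ← ++-conicalˡ Γ Δ (sizes≤0 (Γ ++ Δ) bound) | refl ← ++-conicalʳ Γ Δ (sizes≤0 (Γ ++ Δ) bound) =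
    weakenʳ ⊥' (perm (↭-reflexive (++-identityʳ _)) refl d)
  𝓘-uniform (suc k) Γ Δ bound = 𝓘-step-uniform (𝓘-uniform k) Γ Δ (shape Γ Δ) bound

  interpolant-sound : Sound interpolant
  interpolant-sound Γ Δ = 𝓘-sound (sizes (Γ ++ Δ)) Γ Δ

  interpolant-uniform : ∀ Γ Δ → Uniform (interpolant Γ Δ) Γ Δ
  interpolant-uniform Γ Δ = 𝓘-uniform (sizes (Γ ++ Δ)) Γ Δ ≤-refl

corollary3p21 : (n : ℕ) (L : Logic) → PreInterpolants n L × PostInterpolants n L
corollary3p21 n L = pre , post
  where
  open Derivations {n} L

  pre : PreInterpolants n L
  pre B qs rs qs#rs _ =
    I , Free⇒Disjoint I (Free-interpolant [] (B ∷ [])) , to∣⊢ (interpolant-sound [] (B ∷ [])) ,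
    λ A ps _ ps#rs A-over A⊢B →
      to∣⊢ (interpolant-uniform [] (B ∷ []) {A ∷ []} (over⇒Free A ps ps#rs qs#rs A-over ∷ []) []
              (from∣⊢ A⊢B))
    where
    open Interpolant rs
    open Correctness L rs
    I = interpolant [] (B ∷ [])

  post : PostInterpolants n L
  post A ps qs qs#ps _ =
    ¬' I , Free⇒Disjoint I (Free-interpolant (A ∷ []) []) , to∣⊢ (¬ʳ (interpolant-sound (A ∷ []) [])) ,
    λ B rs _ rs#ps B-over A⊢B →
      to∣⊢ (¬ˡ (interpolant-uniform (A ∷ []) [] {Λ = B ∷ []} [] (over⇒Free B qs qs#ps rs#ps B-over ∷ [])
                 (from∣⊢ A⊢B)))
    where
    open Interpolant ps
    open Correctness L ps
    I = interpolant (A ∷ []) []
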